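{- Let $p > 3$ be a prime. Suppose $J$ is a zero-sum sequence in $(\mathbb{Z}/p\mathbb{Z})^3$ with $|J| = 4p$. Then $J$ contains a zero-sum subsequence of length $p$ or a zero-sum subsequence of length $2p$.
   Context: A sequence is a finite list of elements (repetitions allowed); a subsequence is obtained by selecting any subset of the positions (not necessarily consecutive). A sequence is zero-sum if its terms sum to $0$. -}

module Defs where

open import Data.Nat using (ℕ; zero; suc; _+_)
open import Data.Nat.Divisibility using (_∣_)
open import Data.Fin using (Fin; toℕ)
open import Data.Fin.Subset using (Subset; _∈_; inside; outside)
open import Data.Vec using (Vec; []; _∷_)

-- An element of (ℤ/pℤ)^3: three residues, each a canonical
-- representative in Fin p.
G : ℕ → Set
G p = Fin 3 → Fin p

Seq : ℕ → ℕ → Set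
Seq p n = Fin n → G p

coordSum : ∀ {p n} → Subset n → Seq p n → Fin 3 → ℕ
coordSum [] f i = 0
coordSum (outside ∷ s) f i = coordSum s (λ k → f (Data.Fin.suc k)) i
coordSum (inside ∷ s) f i = toℕ (f Data.Fin.zero i) + coordSum s (λ k → f (Data.Fin.suc k)) i

ZeroSumSub : ∀ {p n} → Seq p n → Subset n → Set
ZeroSumSub {p} f s = ∀ (i : Fin 3) → p ∣ coordSum s f i

full : ∀ n → Subset n
full zero = []
full (suc n) = inside ∷ full n

ZeroSum : ∀ {p n} → Seq p n → Set
ZeroSum {n = n} f = ZeroSumSub f (full n)

module Submission where

-- A function on subsets of {0,…,n-1} is a function of n Boolean
-- variables; its alternating sum Σ_s (-1)^|s| f(s) vanishes as soon as f
-- is a polynomial of degree < n in those variables.  With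
-- Z(x) = (1 - x)(2 - x)⋯(p-1 - x), which mod p is (p-1)! on multiples of
-- p and 0 elsewhere, put
--     h(s) = Z(σ₀(s)) · Z(σ₁(s)) · Z(σ₂(s)) · Z(|s|),
-- where σᵢ(s) is the i-th coordinate sum of the subsequence s.  Each σᵢ
-- and |s| is affine, so h has degree 4(p-1) < n and its alternating sum
-- is 0.  If J had no zero-sum subsequence of length p or 2p, then the
-- only subsets s with all four arguments ≡ 0 mod p would be ∅ and the
-- whole set (a zero-sum s of size 3p has a complement of size p), so mod p
-- the alternating sum of h equals 2·((p-1)!)^4, which is nonzero.

open import Defs
open import Data.Nat as ℕ using (ℕ; zero; suc; _≤_; _<_; _>_; s≤s; _!)
import Data.Nat.Properties as ℕP
open import Data.Nat.Divisibility
  using (divides; _∣?_; ∣1⇒≡1; ∣⇒≤; n∣m*n; m%n≡0⇒n∣m; ∣m+n∣m⇒∣n)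
  renaming (_∣_ to _∣ℕ_; _∣0 to _∣ℕ0)
open import Data.Nat.DivMod using (_%_; _/_; m≡m%n+[m/n]*n; m%n<n)
open import Data.Nat.Primality using (Prime; euclidsLemma; ¬prime[0]; ¬prime[1])
import Data.Nat.Tactic.RingSolver as ℕSolver
open import Data.Integer as ℤ using (ℤ; +_; _+_; _-_; _*_; -_; 0ℤ; 1ℤ; -1ℤ; _^_)
import Data.Integer.Properties as ℤP
open import Data.Integer.Divisibility.Signed
  using (_∣_; ∣-refl; ∣-trans; ∣⇒∣ᵤ; ∣ᵤ⇒∣; ∣m∣n⇒∣m+n; ∣m∣n⇒∣m-n; ∣m⇒∣-m;
         ∣m⇒∣m*n; ∣n⇒∣m*n)
open import Data.Integer.Tactic.RingSolver using (solve-∀)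
open import Data.Fin using (Fin; toℕ) renaming (zero to fzero; suc to fsuc)
open import Data.Fin.Properties using (all?)
open import Data.Fin.Subset using (Subset; inside; outside; ∣_∣; ∁) renaming (⊥ to ∅; ⊤ to all)
open import Data.Fin.Subset.Properties
  using (∣⊥∣≡0; ∣⊤∣≡n; ∣p∣≡n⇒p≡⊤; ∣∁p∣≡n∸∣p∣; ∣p∣≤n; anySubset?)
open import Data.Vec using ([]; _∷_)
open import Data.Product using (∃; _×_; _,_; proj₁; proj₂)
open import Data.Sum using (_⊎_; inj₁; inj₂)
open import Data.Empty using (⊥; ⊥-elim)
open import Data.Unit using (⊤; tt)
open import Function using (_∘_)
open import Relation.Nullary using (¬_; Dec; yes; no)
open import Relation.Nullary.Decidable using (_×-dec_; _⊎-dec_)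
open import Relation.Binary.PropositionalEquality
open ≡-Reasoning

-- (1) Alternating sums and degree of functions on subsets

Fun : ℕ → Set
Fun n = Subset n → ℤ

restrictOut restrictIn : ∀ {n} → Fun (suc n) → Fun n
restrictOut f s = f (outside ∷ s)
restrictIn f s = f (inside ∷ s)

Δ : ∀ {n} → Fun (suc n) → Fun n
Δ f s = restrictIn f s - restrictOut f s

alt : ∀ {n} → Fun n → ℤ
alt {zero} f = f []
alt {suc n} f = alt (restrictOut f) - alt (restrictIn f)

alt-zero : ∀ {n} {f : Fun n} → (∀ s → f s ≡ 0ℤ) → alt f ≡ 0ℤ
alt-zero {zero} f≡0 = f≡0 []
alt-zero {suc n} f≡0 = cong₂ _-_ (alt-zero (f≡0 ∘ (outside ∷_))) (alt-zero (f≡0 ∘ (inside ∷_)))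

alt-+ : ∀ {n} (f g : Fun n) → alt (λ s → f s + g s) ≡ alt f + alt g
alt-+ {zero} f g = refl
alt-+ {suc n} f g = begin
  alt (λ s → f (outside ∷ s) + g (outside ∷ s)) - alt (λ s → f (inside ∷ s) + g (inside ∷ s))
    ≡⟨ cong₂ _-_ (alt-+ (restrictOut f) (restrictOut g)) (alt-+ (restrictIn f) (restrictIn g)) ⟩
  (alt (restrictOut f) + alt (restrictOut g)) - (alt (restrictIn f) + alt (restrictIn g))
    ≡⟨ interchange (alt (restrictOut f)) (alt (restrictOut g)) (alt (restrictIn f)) (alt (restrictIn g)) ⟩
  alt f + alt g ∎
  where
  interchange : ∀ a b c d → (a + b) - (c + d) ≡ (a - c) + (b - d)
  interchange = solve-∀

alt-- : ∀ {n} (f g : Fun n) → alt (λ s → f s - g s) ≡ alt f - alt g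
alt-- {zero} f g = refl
alt-- {suc n} f g = begin
  alt (λ s → f (outside ∷ s) - g (outside ∷ s)) - alt (λ s → f (inside ∷ s) - g (inside ∷ s))
    ≡⟨ cong₂ _-_ (alt-- (restrictOut f) (restrictOut g)) (alt-- (restrictIn f) (restrictIn g)) ⟩
  (alt (restrictOut f) - alt (restrictOut g)) - (alt (restrictIn f) - alt (restrictIn g))
    ≡⟨ interchange (alt (restrictOut f)) (alt (restrictOut g)) (alt (restrictIn f)) (alt (restrictIn g)) ⟩
  alt f - alt g ∎
  where
  interchange : ∀ a b c d → (a - b) - (c - d) ≡ (a - c) - (b - d)
  interchange = solve-∀

-- Deg< k f: f is a polynomial of degree < k in the n Boolean variables,
-- defined by recursion: the restriction to the first variable being 0
-- has degree < k and the derivative in it has degree < k - 1.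
Deg< : ∀ {n} → ℕ → Fun n → Set
Deg< zero f = ∀ s → f s ≡ 0ℤ
Deg< {zero} (suc k) f = ⊤
Deg< {suc n} (suc k) f = Deg< (suc k) (restrictOut f) × Deg< k (Δ f)

-- The fundamental vanishing: a polynomial of degree < n in n Boolean
-- variables has alternating sum 0, since alt f = - alt (Δ f).
alt-vanish : ∀ {n} k (f : Fun n) → Deg< k f → k ≤ n → alt f ≡ 0ℤ
alt-vanish zero f f≡0 _ = alt-zero f≡0
alt-vanish {suc n} (suc k) f (_ , degΔ) (s≤s k≤n) = begin
  alt (restrictOut f) - alt (restrictIn f) ≡⟨ antisym (alt (restrictOut f)) (alt (restrictIn f)) ⟩
  - (alt (restrictIn f) - alt (restrictOut f)) ≡⟨ cong -_ (alt-- (restrictIn f) (restrictOut f)) ⟨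
  - alt (Δ f) ≡⟨ cong -_ (alt-vanish k (Δ f) degΔ k≤n) ⟩
  0ℤ ∎
  where
  antisym : ∀ a b → a - b ≡ - (b - a)
  antisym = solve-∀

Deg-resp : ∀ {n} k {f g : Fun n} → (∀ s → f s ≡ g s) → Deg< k f → Deg< k g
Deg-resp zero f≡g deg s = trans (sym (f≡g s)) (deg s)
Deg-resp {zero} (suc k) f≡g deg = tt
Deg-resp {suc n} (suc k) f≡g (degOut , degΔ) =
  Deg-resp (suc k) (f≡g ∘ (outside ∷_)) degOut ,
  Deg-resp k (λ s → cong₂ _-_ (f≡g (inside ∷ s)) (f≡g (outside ∷ s))) degΔ

Deg-zero : ∀ {n} k {f : Fun n} → (∀ s → f s ≡ 0ℤ) → Deg< k f
Deg-zero zero f≡0 = f≡0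
Deg-zero {zero} (suc k) f≡0 = tt
Deg-zero {suc n} (suc k) f≡0 =
  Deg-zero (suc k) (f≡0 ∘ (outside ∷_)) ,
  Deg-zero k (λ s → cong₂ _-_ (f≡0 (inside ∷ s)) (f≡0 (outside ∷ s)))

Deg-suc : ∀ {n} k {f : Fun n} → Deg< k f → Deg< (suc k) f
Deg-suc zero deg = Deg-zero 1 deg
Deg-suc {zero} (suc k) deg = tt
Deg-suc {suc n} (suc k) (degOut , degΔ) = Deg-suc (suc k) degOut , Deg-suc k degΔ

Deg-const : ∀ {n} c → Deg< {n} 1 (λ _ → c)
Deg-const {zero} c = tt
Deg-const {suc n} c = Deg-const c , (λ _ → ℤP.+-inverseʳ c)

Deg-+ : ∀ {n} k {f g : Fun n} → Deg< k f → Deg< k g → Deg< k (λ s → f s + g s)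
Deg-+ zero degf degg s = cong₂ _+_ (degf s) (degg s)
Deg-+ {zero} (suc k) degf degg = tt
Deg-+ {suc n} (suc k) {f} {g} (f₀ , f′) (g₀ , g′) =
  Deg-+ (suc k) f₀ g₀ ,
  Deg-resp k (λ s → interchange (f (inside ∷ s)) (f (outside ∷ s)) (g (inside ∷ s)) (g (outside ∷ s)))
    (Deg-+ k f′ g′)
  where
  interchange : ∀ a b c d → (a - b) + (c - d) ≡ (a + c) - (b + d)
  interchange = solve-∀

-- Degrees add under multiplication; the derivative obeys the product rule
-- Δ(fg) = Δf · g(in) + Δg · f(out).
Deg-* : ∀ {n} k e {f g : Fun n} → Deg< k f → Deg< (suc e) g → Deg< (k ℕ.+ e) (λ s → f s * g s)
Deg-* zero e {f} {g} degf degg =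
  Deg-zero e (λ s → trans (cong (_* g s) (degf s)) (ℤP.*-zeroˡ (g s)))
Deg-* {zero} (suc d) e degf degg = tt
Deg-* {suc n} (suc d) e {f} {g} (f₀ , f′) (g₀ , g′) =
  Deg-* (suc d) e f₀ g₀ ,
  Deg-resp (d ℕ.+ e)
    (λ s → productRule (f (inside ∷ s)) (f (outside ∷ s)) (g (inside ∷ s)) (g (outside ∷ s)))
    (Deg-+ (d ℕ.+ e) (Deg-* d e f′ gIn)
      (subst (λ k → Deg< k (λ s → Δ g s * f (outside ∷ s))) (ℕP.+-comm e d) (Deg-* e d g′ f₀)))
  where
  gIn : Deg< (suc e) (restrictIn g)
  gIn = Deg-resp (suc e) (λ s → outPlusΔ (g (inside ∷ s)) (g (outside ∷ s)))
          (Deg-+ (suc e) g₀ (Deg-suc e g′))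
    where
    outPlusΔ : ∀ a b → b + (a - b) ≡ a
    outPlusΔ = solve-∀
  productRule : ∀ a b c d → (a - b) * c + (c - d) * b ≡ a * c - b * d
  productRule = solve-∀

Deg-c- : ∀ {n} c {f : Fun n} → Deg< 2 f → Deg< 2 (λ s → c - f s)
Deg-c- c {f} degf =
  Deg-resp 2 (λ s → negate (f s)) (Deg-+ 2 (Deg-suc 1 (Deg-const c)) (Deg-* 1 1 (Deg-const -1ℤ) degf))
  where
  negate : ∀ x → c + -1ℤ * x ≡ c - x
  negate = solve-∀

Deg-affine : ∀ {n} (c : ℕ) (f : Subset (suc n) → ℕ) →
  Deg< 2 (λ s → + f (outside ∷ s)) → (∀ s → f (inside ∷ s) ≡ c ℕ.+ f (outside ∷ s)) →
  Deg< 2 (λ s → + f s)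
Deg-affine c f degOut step =
  degOut , Deg-resp 1 (λ s → sym (increment s)) (Deg-const (+ c))
  where
  increment : ∀ s → + f (inside ∷ s) - + f (outside ∷ s) ≡ + c
  increment s = begin
    + f (inside ∷ s) - + f (outside ∷ s) ≡⟨ cong (λ m → + m - + f (outside ∷ s)) (step s) ⟩
    + (c ℕ.+ f (outside ∷ s)) - + f (outside ∷ s) ≡⟨ cong (_- + f (outside ∷ s)) (ℤP.pos-+ c _) ⟩
    (+ c + + f (outside ∷ s)) - + f (outside ∷ s) ≡⟨ cancel (+ c) (+ f (outside ∷ s)) ⟩
    + c ∎
    where
    cancel : ∀ x y → (x + y) - y ≡ x
    cancel = solve-∀

-- (2) Congruences modulo p and the polynomial Z

infix 4 _≡_[mod_]
_≡_[mod_] : ℤ → ℤ → ℕ → Set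
x ≡ y [mod p ] = + p ∣ x - y

mod-respʳ : ∀ {p x y z} → y ≡ z → x ≡ y [mod p ] → x ≡ z [mod p ]
mod-respʳ refl x≡y = x≡y

multiple≡0 : ∀ {p x} → + p ∣ x → x ≡ 0ℤ [mod p ]
multiple≡0 {p} {x} p∣x = subst (+ p ∣_) (sym (ℤP.+-identityʳ x)) p∣x

mod-* : ∀ {p a b α β} → a ≡ α [mod p ] → b ≡ β [mod p ] → a * b ≡ α * β [mod p ]
mod-* {p} {a} {b} {α} {β} a≡α b≡β =
  subst (+ p ∣_) (expand a b α β) (∣m∣n⇒∣m+n (∣m⇒∣m*n b a≡α) (∣n⇒∣m*n α b≡β))
  where
  expand : ∀ a b α β → (a - α) * b + α * (b - β) ≡ a * b - α * β
  expand = solve-∀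

alt-mod : ∀ {n p} {f g : Fun n} → (∀ s → f s ≡ g s [mod p ]) → alt f ≡ alt g [mod p ]
alt-mod {zero} f≡g = f≡g []
alt-mod {suc n} {p} {f} {g} f≡g =
  subst (+ p ∣_) (interchange (alt (restrictOut f)) (alt (restrictIn f)) (alt (restrictOut g)) (alt (restrictIn g)))
    (∣m∣n⇒∣m-n (alt-mod {f = restrictOut f} {g = restrictOut g} (f≡g ∘ (outside ∷_)))
               (alt-mod {f = restrictIn f} {g = restrictIn g} (f≡g ∘ (inside ∷_))))
  where
  interchange : ∀ a b c d → (a - c) - (b - d) ≡ (a - b) - (c - d)
  interchange = solve-∀

prime-∤-* : ∀ {p} → Prime p → ∀ {a b} → ¬ (+ p ∣ a) → ¬ (+ p ∣ b) → ¬ (+ p ∣ a * b)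
prime-∤-* p-prime {a} {b} p∤a p∤b p∣ab
  with euclidsLemma (ℤ.∣ a ∣) (ℤ.∣ b ∣) p-prime (subst (_ ∣ℕ_) (ℤP.abs-* a b) (∣⇒∣ᵤ p∣ab))
... | inj₁ p∣a = p∤a (∣ᵤ⇒∣ p∣a)
... | inj₂ p∣b = p∤b (∣ᵤ⇒∣ p∣b)

prime-∤-! : ∀ {p} → Prime p → ∀ k → k < p → ¬ (p ∣ℕ k !)
prime-∤-! p-prime zero _ p∣1 with ∣1⇒≡1 p∣1
... | refl = ¬prime[1] p-prime
prime-∤-! p-prime (suc k) k<p p∣k!
  with euclidsLemma (suc k) (k !) p-prime p∣k!
... | inj₁ p∣k = ℕP.<⇒≱ k<p (∣⇒≤ p∣k)
... | inj₂ p∣k! = prime-∤-! p-prime k (ℕP.<-trans (ℕP.n<1+n k) k<p) p∣k!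

Z : ℕ → ℤ → ℤ
Z zero x = 1ℤ
Z (suc k) x = (+ suc k - x) * Z k x

Z-deg : ∀ {n} k (f : Fun n) → Deg< 2 f → Deg< (suc k) (λ s → Z k (f s))
Z-deg zero f degf = Deg-const 1ℤ
Z-deg (suc k) f degf = Deg-* 2 k (Deg-c- (+ suc k) degf) (Z-deg k f degf)

Z-factor : ∀ k {c} x → 1 ≤ c → c ≤ k → (+ c - x) ∣ Z k x
Z-factor zero x 1≤c c≤0 = ⊥-elim (ℕP.<⇒≱ 1≤c c≤0)
Z-factor (suc k) x 1≤c c≤1+k with ℕP.m≤n⇒m<n∨m≡n c≤1+k
... | inj₁ (s≤s c≤k) = ∣n⇒∣m*n (+ suc k - x) (Z-factor k x 1≤c c≤k)
... | inj₂ refl = ∣m⇒∣m*n (Z k x) ∣-refl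

Z-multiple : ∀ {p} k {x} → + p ∣ x → Z k x ≡ + (k !) [mod p ]
Z-multiple zero {x} p∣x = multiple≡0 {x = 0ℤ} (∣ᵤ⇒∣ (_ ∣ℕ0))
Z-multiple {p} (suc k) {x} p∣x =
  mod-respʳ {x = Z (suc k) x} (sym (ℤP.pos-* (suc k) (k !)))
    (mod-* {a = + suc k - x} {b = Z k x}
      (subst (+ p ∣_) (dropConst (+ suc k) x) (∣m⇒∣-m p∣x)) (Z-multiple k p∣x))
  where
  dropConst : ∀ c x → - x ≡ (c - x) - c
  dropConst = solve-∀

-- Off multiples of p, Z (p - 1) ≡ 0 mod p: x ≡ x % p with 1 ≤ x % p ≤ p - 1.
Z-nonmultiple : ∀ q {x} → ¬ (suc q ∣ℕ x) → + suc q ∣ Z q (+ x)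
Z-nonmultiple q {x} p∤x = ∣-trans p∣factor (Z-factor q (+ x) 1≤r r≤q)
  where
  r = x % suc q
  1≤r : 1 ≤ r
  1≤r = ℕP.n≢0⇒n>0 (λ r≡0 → p∤x (m%n≡0⇒n∣m x (suc q) r≡0))
  r≤q : r ≤ q
  r≤q = ℕP.≤-pred (m%n<n x (suc q))
  m = x / suc q
  p∣factor : + suc q ∣ + r - + x
  p∣factor = subst (+ suc q ∣_) (sym remainder) (∣m⇒∣-m (∣ᵤ⇒∣ (n∣m*n m)))
    where
    cancel : ∀ a b → a - (a + b) ≡ - b
    cancel = solve-∀
    remainder : + r - + x ≡ - + (m ℕ.* suc q)
    remainder = begin
      + r - + x                        ≡⟨ cong (λ y → + r - + y) (m≡m%n+[m/n]*n x (suc q)) ⟩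
      + r - + (r ℕ.+ m ℕ.* suc q)      ≡⟨ cong (λ y → + r - y) (ℤP.pos-+ r (m ℕ.* suc q)) ⟩
      + r - (+ r + + (m ℕ.* suc q))    ≡⟨ cancel (+ r) _ ⟩
      - + (m ℕ.* suc q)                ∎

-- IndicatorMod p A a α: A is decided, and a ≡ α mod p when A holds while
-- a ≡ 0 mod p when it fails; i.e. a ≡ [A]·α (mod p).
IndicatorMod : ℕ → Set → ℤ → ℤ → Set
IndicatorMod p A a α = (A × a ≡ α [mod p ]) ⊎ (¬ A × + p ∣ a)

indicator-* : ∀ {p A B a b α β} → IndicatorMod p A a α → IndicatorMod p B b β →
  IndicatorMod p (A × B) (a * b) (α * β)
indicator-* {a = a} {b} (inj₁ (holdsA , a≡α)) (inj₁ (holdsB , b≡β)) =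
  inj₁ ((holdsA , holdsB) , mod-* {a = a} {b} a≡α b≡β)
indicator-* {b = b} (inj₂ (failsA , p∣a)) _ = inj₂ (failsA ∘ proj₁ , ∣m⇒∣m*n b p∣a)
indicator-* {a = a} (inj₁ _) (inj₂ (failsB , p∣b)) = inj₂ (failsB ∘ proj₂ , ∣n⇒∣m*n a p∣b)

Z-indicator : ∀ q x → IndicatorMod (suc q) (suc q ∣ℕ x) (Z q (+ x)) (+ (q !))
Z-indicator q x with suc q ∣? x
... | yes p∣x = inj₁ (p∣x , Z-multiple q (∣ᵤ⇒∣ p∣x))
... | no p∤x = inj₂ (p∤x , Z-nonmultiple q p∤x)

-- (3) Point masses

point : ∀ {n} → Subset n → ℤ → Fun n
point [] c [] = c
point (inside ∷ t) c (inside ∷ s) = point t c s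
point (inside ∷ t) c (outside ∷ s) = 0ℤ
point (outside ∷ t) c (inside ∷ s) = 0ℤ
point (outside ∷ t) c (outside ∷ s) = point t c s

point-at : ∀ {n} (t : Subset n) c → point t c t ≡ c
point-at [] c = refl
point-at (inside ∷ t) c = point-at t c
point-at (outside ∷ t) c = point-at t c

point-off : ∀ {n} (t s : Subset n) c → s ≢ t → point t c s ≡ 0ℤ
point-off [] [] c []≢[] = ⊥-elim ([]≢[] refl)
point-off (inside ∷ t) (inside ∷ s) c s≢t = point-off t s c (s≢t ∘ cong (inside ∷_))
point-off (inside ∷ t) (outside ∷ s) c _ = refl
point-off (outside ∷ t) (inside ∷ s) c _ = refl
point-off (outside ∷ t) (outside ∷ s) c s≢t = point-off t s c (s≢t ∘ cong (outside ∷_))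

alt-point : ∀ {n} (t : Subset n) c → alt (point t c) ≡ -1ℤ ^ ∣ t ∣ * c
alt-point [] c = sym (ℤP.*-identityˡ c)
alt-point {suc n} (inside ∷ t) c = begin
  alt {n} (λ _ → 0ℤ) - alt (point t c) ≡⟨ cong₂ _-_ (alt-zero {n} (λ _ → refl)) (alt-point t c) ⟩
  0ℤ - -1ℤ ^ ∣ t ∣ * c             ≡⟨ flip (-1ℤ ^ ∣ t ∣) c ⟩
  -1ℤ * -1ℤ ^ ∣ t ∣ * c            ∎
  where
  flip : ∀ a c → 0ℤ - a * c ≡ -1ℤ * a * c
  flip = solve-∀
alt-point {suc n} (outside ∷ t) c = begin
  alt (point t c) - alt {n} (λ _ → 0ℤ) ≡⟨ cong₂ _-_ (alt-point t c) (alt-zero {n} (λ _ → refl)) ⟩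
  -1ℤ ^ ∣ t ∣ * c - 0ℤ             ≡⟨ ℤP.+-identityʳ _ ⟩
  -1ℤ ^ ∣ t ∣ * c                  ∎

even-sign : ∀ m → -1ℤ ^ (2 ℕ.* m) ≡ 1ℤ
even-sign m = trans (sym (ℤP.^-*-assoc -1ℤ 2 m)) (ℤP.^-zeroˡ m)

-- (4) The affine functions attached to a sequence

tailSeq : ∀ {p n} → Seq p (suc n) → Seq p n
tailSeq f k = f (fsuc k)

coordSum-affine : ∀ {p n} (f : Seq p n) i → Deg< 2 (λ s → + coordSum s f i)
coordSum-affine {n = zero} f i = tt
coordSum-affine {n = suc n} f i =
  Deg-affine (toℕ (f fzero i)) (λ s → coordSum s f i) (coordSum-affine (tailSeq f) i) (λ _ → refl)

size-affine : ∀ n → Deg< {n} 2 (λ s → + ∣ s ∣)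
size-affine zero = tt
size-affine (suc n) = Deg-affine 1 ∣_∣ (size-affine n) (λ _ → refl)

coordSum-∅ : ∀ {p n} (f : Seq p n) i → coordSum ∅ f i ≡ 0
coordSum-∅ {n = zero} f i = refl
coordSum-∅ {n = suc n} f i = coordSum-∅ (tailSeq f) i

full≡all : ∀ n → full n ≡ all
full≡all zero = refl
full≡all (suc n) = cong (inside ∷_) (full≡all n)

coordSum-∁ : ∀ {p n} (s : Subset n) (f : Seq p n) i →
  coordSum s f i ℕ.+ coordSum (∁ s) f i ≡ coordSum (full n) f i
coordSum-∁ [] f i = refl
coordSum-∁ (outside ∷ s) f i = begin
  coordSum s (tailSeq f) i ℕ.+ (toℕ (f fzero i) ℕ.+ coordSum (∁ s) (tailSeq f) i)
    ≡⟨ swap (coordSum s (tailSeq f) i) (toℕ (f fzero i)) (coordSum (∁ s) (tailSeq f) i) ⟩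
  toℕ (f fzero i) ℕ.+ (coordSum s (tailSeq f) i ℕ.+ coordSum (∁ s) (tailSeq f) i)
    ≡⟨ cong (toℕ (f fzero i) ℕ.+_) (coordSum-∁ s (tailSeq f) i) ⟩
  toℕ (f fzero i) ℕ.+ coordSum (full _) (tailSeq f) i ∎
  where
  swap : ∀ a b c → a ℕ.+ (b ℕ.+ c) ≡ b ℕ.+ (a ℕ.+ c)
  swap = ℕSolver.solve-∀
coordSum-∁ (inside ∷ s) f i =
  trans (ℕP.+-assoc (toℕ (f fzero i)) _ _) (cong (toℕ (f fzero i) ℕ.+_) (coordSum-∁ s (tailSeq f) i))

size0⇒∅ : ∀ {n} (s : Subset n) → ∣ s ∣ ≡ 0 → s ≡ ∅
size0⇒∅ [] _ = refl
size0⇒∅ (outside ∷ s) ∣s∣≡0 = cong (outside ∷_) (size0⇒∅ s ∣s∣≡0)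

module NoShortZeroSum
  (q : ℕ) (p-prime : Prime (suc q)) (J : Seq (suc q) (4 ℕ.* suc q)) (zeroSum : ZeroSum J)
  (none : ∀ s → ZeroSumSub J s → ∣ s ∣ ≡ suc q ⊎ ∣ s ∣ ≡ 2 ℕ.* suc q → ⊥)
  where

  p n : ℕ
  p = suc q
  n = 4 ℕ.* p

  ∅ₙ allₙ : Subset n
  ∅ₙ = ∅
  allₙ = all

  σ : Subset n → Fin 3 → ℕ
  σ s i = coordSum s J i

  i₀ i₁ i₂ : Fin 3
  i₀ = fzero
  i₁ = fsuc fzero
  i₂ = fsuc (fsuc fzero)

  Good : Subset n → Set
  Good s = ((p ∣ℕ σ s i₀ × p ∣ℕ σ s i₁) × p ∣ℕ σ s i₂) × p ∣ℕ ∣ s ∣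

  good⇒zeroSum : ∀ {s} → Good s → ZeroSumSub J s
  good⇒zeroSum (((d₀ , _) , _) , _) fzero = d₀
  good⇒zeroSum (((_ , d₁) , _) , _) (fsuc fzero) = d₁
  good⇒zeroSum ((_ , d₂) , _) (fsuc (fsuc fzero)) = d₂

  ∅-good : Good ∅ₙ
  ∅-good = ((zero-sum i₀ , zero-sum i₁) , zero-sum i₂) , subst (p ∣ℕ_) (sym (∣⊥∣≡0 n)) (p ∣ℕ0)
    where
    zero-sum : ∀ i → p ∣ℕ σ ∅ₙ i
    zero-sum i = subst (p ∣ℕ_) (sym (coordSum-∅ J i)) (p ∣ℕ0)

  all-good : Good allₙ
  all-good = ((zero-sum i₀ , zero-sum i₁) , zero-sum i₂) , subst (p ∣ℕ_) (sym (∣⊤∣≡n n)) (n∣m*n 4)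
    where
    zero-sum : ∀ i → p ∣ℕ σ allₙ i
    zero-sum i = subst (λ t → p ∣ℕ coordSum t J i) (full≡all n) (zeroSum i)

  -- A good subset has size cp with c ≤ 4; c = 1, 2 are excluded by
  -- hypothesis and c = 3 by passing to the complement, of size p.
  good-trivial : ∀ s → Good s → s ≡ ∅ₙ ⊎ s ≡ allₙ
  good-trivial s good@(_ , divides c ∣s∣≡cp) =
    byMultiple c ∣s∣≡cp (ℕP.*-cancelʳ-≤ c 4 p (subst (ℕ._≤ n) ∣s∣≡cp (∣p∣≤n s)))
    where
    zeroSum-s : ZeroSumSub J s
    zeroSum-s = good⇒zeroSum {s} good
    byMultiple : ∀ c → ∣ s ∣ ≡ c ℕ.* p → c ≤ 4 → s ≡ ∅ₙ ⊎ s ≡ allₙ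
    byMultiple 0 ∣s∣≡0 _ = inj₁ (size0⇒∅ s ∣s∣≡0)
    byMultiple 1 ∣s∣≡p _ = ⊥-elim (none s zeroSum-s (inj₁ (trans ∣s∣≡p (ℕP.*-identityˡ p))))
    byMultiple 2 ∣s∣≡2p _ = ⊥-elim (none s zeroSum-s (inj₂ ∣s∣≡2p))
    byMultiple 3 ∣s∣≡3p _ = ⊥-elim (none (∁ s) complement-zeroSum (inj₁ complement-size))
      where
      complement-size : ∣ ∁ s ∣ ≡ p
      complement-size =
        trans (∣∁p∣≡n∸∣p∣ s) (trans (cong (n ℕ.∸_) ∣s∣≡3p) (ℕP.m+n∸n≡m p (3 ℕ.* p)))
      complement-zeroSum : ZeroSumSub J (∁ s)
      complement-zeroSum i =
        ∣m+n∣m⇒∣n (subst (p ∣ℕ_) (sym (coordSum-∁ s J i)) (zeroSum i)) (zeroSum-s i)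
    byMultiple 4 ∣s∣≡n _ = inj₂ (∣p∣≡n⇒p≡⊤ ∣s∣≡n)
    byMultiple (suc (suc (suc (suc (suc c))))) _ (s≤s (s≤s (s≤s (s≤s ()))))

  Zσ : Fin 3 → Fun n
  Zσ i s = Z q (+ σ s i)

  Z∣∣ : Fun n
  Z∣∣ s = Z q (+ ∣ s ∣)

  h : Fun n
  h s = Zσ i₀ s * Zσ i₁ s * Zσ i₂ s * Z∣∣ s

  alt-h : alt h ≡ 0ℤ
  alt-h = alt-vanish (suc q ℕ.+ q ℕ.+ q ℕ.+ q) h deg-h deg<n
    where
    deg-h : Deg< (suc q ℕ.+ q ℕ.+ q ℕ.+ q) h
    deg-h = Deg-* _ q {f = λ s → Zσ i₀ s * Zσ i₁ s * Zσ i₂ s} {g = Z∣∣}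
              (Deg-* _ q {f = λ s → Zσ i₀ s * Zσ i₁ s} {g = Zσ i₂}
                (Deg-* _ q {f = Zσ i₀} {g = Zσ i₁} (Zσ-deg i₀) (Zσ-deg i₁))
                (Zσ-deg i₂))
              (Z-deg q (λ s → + ∣ s ∣) (size-affine n))
      where
      Zσ-deg : ∀ i → Deg< (suc q) (Zσ i)
      Zσ-deg i = Z-deg q (λ s → + σ s i) (coordSum-affine J i)
    deg<n : suc q ℕ.+ q ℕ.+ q ℕ.+ q ≤ n
    deg<n = subst (suc q ℕ.+ q ℕ.+ q ℕ.+ q ≤_) (sym (n≡deg+3 q)) (ℕP.m≤m+n _ 3)
      where
      n≡deg+3 : ∀ q → 4 ℕ.* suc q ≡ (suc q ℕ.+ q ℕ.+ q ℕ.+ q) ℕ.+ 3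
      n≡deg+3 = ℕSolver.solve-∀

  -- W = (q!)^4 is the common value of h mod p at the good subsets.
  W : ℤ
  W = + (q !) * + (q !) * + (q !) * + (q !)

  ends : Fun n
  ends s = point ∅ₙ W s + point allₙ W s

  ends-∅ : ends ∅ₙ ≡ W
  ends-∅ = trans (cong₂ _+_ (point-at ∅ₙ W) (point-off allₙ ∅ₙ W λ ())) (ℤP.+-identityʳ W)

  ends-all : ends allₙ ≡ W
  ends-all = trans (cong₂ _+_ (point-off ∅ₙ allₙ W λ ()) (point-at allₙ W)) (ℤP.+-identityˡ W)

  ends-elsewhere : ∀ s → s ≢ ∅ₙ → s ≢ allₙ → ends s ≡ 0ℤ
  ends-elsewhere s s≢∅ s≢all = cong₂ _+_ (point-off ∅ₙ s W s≢∅) (point-off allₙ s W s≢all)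

  -- Mod p, h ≡ ends: at good subsets h ≡ W, and these are ∅ and the full
  -- set; elsewhere some factor of h vanishes mod p.
  h≡ends : ∀ s → h s ≡ ends s [mod p ]
  h≡ends s with indicator-* (indicator-* (indicator-* (Z-indicator q (σ s i₀)) (Z-indicator q (σ s i₁)))
                                          (Z-indicator q (σ s i₂)))
                             (Z-indicator q ∣ s ∣)
  ... | inj₁ (good , h≡W) with good-trivial s good
  ...   | inj₁ refl = mod-respʳ {x = h ∅ₙ} (sym ends-∅) h≡W
  ...   | inj₂ refl = mod-respʳ {x = h allₙ} (sym ends-all) h≡W
  h≡ends s | inj₂ (bad , p∣h) =
    mod-respʳ {x = h s}
      (sym (ends-elsewhere s (bad ∘ λ { refl → ∅-good }) (bad ∘ λ { refl → all-good })))
      (multiple≡0 {x = h s} p∣h)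

  -- The alternating sum of ends is W + (-1)^n W = 2W, as n = 4p is even.
  alt-ends : alt ends ≡ W + W
  alt-ends = begin
    alt ends ≡⟨ alt-+ (point ∅ₙ W) (point allₙ W) ⟩
    alt (point ∅ₙ W) + alt (point allₙ W) ≡⟨ cong₂ _+_ (alt-point ∅ₙ W) (alt-point allₙ W) ⟩
    -1ℤ ^ ∣ ∅ₙ ∣ * W + -1ℤ ^ ∣ allₙ ∣ * W
      ≡⟨ cong₂ (λ a b → -1ℤ ^ a * W + -1ℤ ^ b * W) (∣⊥∣≡0 n) (∣⊤∣≡n n) ⟩
    1ℤ * W + -1ℤ ^ n * W ≡⟨ cong (λ e → 1ℤ * W + e * W) n-even ⟩
    1ℤ * W + 1ℤ * W ≡⟨ cong₂ _+_ (ℤP.*-identityˡ W) (ℤP.*-identityˡ W) ⟩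
    W + W ∎
    where
    n-even : -1ℤ ^ n ≡ 1ℤ
    n-even = trans (cong (-1ℤ ^_) (ℕP.*-assoc 2 2 p)) (even-sign (2 ℕ.* p))

  -- Comparing: 0 = alt h ≡ 2W (mod p), impossible for p > 2.
  contradiction : 2 < p → ⊥
  contradiction p>2 = prime-∤-* p-prime {W} {+ 2} p∤W p∤2 p∣2W
    where
    K = + (q !)
    p∤K : ¬ (+ p ∣ K)
    p∤K p∣K = prime-∤-! p-prime q (ℕP.n<1+n q) (∣⇒∣ᵤ p∣K)
    p∤W : ¬ (+ p ∣ W)
    p∤W = prime-∤-* p-prime {K * K * K} {K}
            (prime-∤-* p-prime {K * K} {K} (prime-∤-* p-prime {K} {K} p∤K p∤K) p∤K) p∤K
    p∤2 : ¬ (+ p ∣ + 2)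
    p∤2 p∣2 = ℕP.<⇒≱ p>2 (∣⇒≤ (∣⇒∣ᵤ p∣2))
    double : ∀ w → - (0ℤ - (w + w)) ≡ w * + 2
    double = solve-∀
    p∣2W : + p ∣ W * + 2
    p∣2W = subst (+ p ∣_) (double W)
             (∣m⇒∣-m (subst (+ p ∣_) (cong₂ _-_ alt-h alt-ends) (alt-mod {f = h} h≡ends)))

solution? : ∀ {p} (J : Seq p (4 ℕ.* p)) (s : Subset (4 ℕ.* p)) →
  Dec (ZeroSumSub J s × (∣ s ∣ ≡ p ⊎ ∣ s ∣ ≡ 2 ℕ.* p))
solution? {p} J s =
  all? (λ i → p ∣? coordSum s J i) ×-dec ((∣ s ∣ ℕ.≟ p) ⊎-dec (∣ s ∣ ℕ.≟ 2 ℕ.* p))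

corollary5p4 : (p : ℕ) → Prime p → p > 3 → (J : Seq p (4 ℕ.* p)) → ZeroSum J →
    ∃ (λ (s : Subset (4 ℕ.* p)) → ZeroSumSub J s × (∣ s ∣ ≡ p ⊎ ∣ s ∣ ≡ 2 ℕ.* p))
corollary5p4 zero p-prime _ _ _ = ⊥-elim (¬prime[0] p-prime)
corollary5p4 (suc q) p-prime p>3 J zeroSum with anySubset? (solution? J)
... | yes solution = solution
... | no noSolution =
  ⊥-elim (NoShortZeroSum.contradiction q p-prime J zeroSum
            (λ s zeroSum-s size → noSolution (s , zeroSum-s , size))
            (ℕP.<-trans (ℕP.n<1+n 2) p>3))
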